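{- Let $\mathcal A$ be a subvariety of the variety of residuated lattices which is $\diamond$-closed, i.e. $A^\diamond\in\mathcal A$ for every $A\in\mathcal A$. Then every absolute retract in $\mathcal A$ is trivial (has exactly one element).
   Context: A residuated lattice is an algebra $\langle A,\wedge,\vee,\odot,\rightarrow,0,1\rangle$ of type $\langle 2,2,2,2,0,0\rangle$ such that $\langle A,\odot,1\rangle$ is a commutative monoid, $\langle A,\vee,\wedge,0,1\rangle$ is a bounded lattice (with order $\le$), and for all $a,b,c$: $a\odot b\le c$ iff $a\le b\rightarrow c$. Homomorphisms preserve all operations including $0,1$. For a residuated lattice $A$, $A^\diamond$ is the set $\{(a,b)\in A\times A : a\le b\}$ with operations $(a_1,b_1)\wedge(a_2,b_2)=(a_1\wedge a_2,b_1\wedge b_2)$, $(a_1,b_1)\vee(a_2,b_2)=(a_1\vee a_2,b_1\vee b_2)$, $(a_1,b_1)\odot(a_2,b_2)=(a_1\odot a_2,(a_1\odot b_2)\vee(a_2\odot b_1))$, $(a_1,b_1)\rightarrow(a_2,b_2)=((a_1\rightarrow a_2)\wedge(b_1\rightarrow b_2), a_1\rightarrow b_2)$, and constants $(0,0)$ and $(1,1)$; this is a residuated lattice. An algebra $A\in\mathcal A$ is an absolute retract in $\mathcal A$ if for every $B\in\mathcal A$ and every injective homomorphism $i:A\to B$ there is a homomorphism $r:B\to A$ with $r\circ i=1_A$. -}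

module Defs where

open import Level using (Level; suc)
open import Data.Nat using (ℕ)
open import Data.Product using (_×_; _,_; proj₁; proj₂; Σ)
open import Relation.Binary.Core using (Rel)
open import Algebra.Core using (Op₂)
open import Algebra.Definitions using (Congruent₂)
open import Algebra.Structures using (IsCommutativeMonoid)
open import Algebra.Lattice.Structures using (IsLattice)

record ResLattice (a : Level) : Set (suc a) where
  infixr 6 _∨_
  infixr 7 _∧_
  infixr 8 _⊙_
  infixr 5 _⇒_
  infix  4 _≈_ _≤_
  field
    Carrier : Set a
    _≈_     : Rel Carrier a
    _∧_ _∨_ _⊙_ _⇒_ : Op₂ Carrier
    𝟘 𝟙     : Carrier

  _≤_ : Rel Carrier a
  x ≤ y = (x ∧ y) ≈ x

  field
    isLattice           : IsLattice _≈_ _∨_ _∧_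
    isCommutativeMonoid : IsCommutativeMonoid _≈_ _⊙_ 𝟙
    ⇒-cong              : Congruent₂ _≈_ _⇒_
    𝟘-bottom            : ∀ x → 𝟘 ≤ x
    𝟙-top               : ∀ x → x ≤ 𝟙
    residuation₁        : ∀ x y z → x ⊙ y ≤ z → x ≤ y ⇒ z
    residuation₂        : ∀ x y z → x ≤ y ⇒ z → x ⊙ y ≤ z

data Term : Set where
  var             : ℕ → Term
  _∧ₜ_ _∨ₜ_ _⊙ₜ_ _⇒ₜ_ : Term → Term → Term
  𝟘ₜ 𝟙ₜ           : Term

evalRaw : ∀ {a} {C : Set a} (m j p i : Op₂ C) (z o : C) → (ℕ → C) → Term → C
evalRaw m j p i z o ρ (var n)  = ρ n
evalRaw m j p i z o ρ (s ∧ₜ t) = m (evalRaw m j p i z o ρ s) (evalRaw m j p i z o ρ t)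
evalRaw m j p i z o ρ (s ∨ₜ t) = j (evalRaw m j p i z o ρ s) (evalRaw m j p i z o ρ t)
evalRaw m j p i z o ρ (s ⊙ₜ t) = p (evalRaw m j p i z o ρ s) (evalRaw m j p i z o ρ t)
evalRaw m j p i z o ρ (s ⇒ₜ t) = i (evalRaw m j p i z o ρ s) (evalRaw m j p i z o ρ t)
evalRaw m j p i z o ρ 𝟘ₜ       = z
evalRaw m j p i z o ρ 𝟙ₜ       = o

⟦_⟧ : ∀ {a} (A : ResLattice a) → Term → (ℕ → ResLattice.Carrier A) → ResLattice.Carrier A
⟦ A ⟧ t ρ = evalRaw _∧_ _∨_ _⊙_ _⇒_ 𝟘 𝟙 ρ t
  where open ResLattice A

-- A set of equations E (a relation on terms) determines a subvariety:
-- the class of residuated lattices satisfying every equation in E.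
Equations : Set₁
Equations = Term → Term → Set

InVariety : ∀ {a} → Equations → ResLattice a → Set a
InVariety E A = ∀ s t → E s t → ∀ (ρ : ℕ → Carrier) → ⟦ A ⟧ s ρ ≈ ⟦ A ⟧ t ρ
  where open ResLattice A

-- The ◇-construction.  The operations of A^◇ are defined on all of
-- A × A; A^◇ is the subset {(a,b) | a ≤ b}, and its equality is
-- componentwise.

module Diamond {a} (A : ResLattice a) where
  open ResLattice A

  Pair : Set a
  Pair = Carrier × Carrier

  _∧◇_ _∨◇_ _⊙◇_ _⇒◇_ : Op₂ Pair
  (a₁ , b₁) ∧◇ (a₂ , b₂) = (a₁ ∧ a₂ , b₁ ∧ b₂)
  (a₁ , b₁) ∨◇ (a₂ , b₂) = (a₁ ∨ a₂ , b₁ ∨ b₂)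
  (a₁ , b₁) ⊙◇ (a₂ , b₂) = (a₁ ⊙ a₂ , (a₁ ⊙ b₂) ∨ (a₂ ⊙ b₁))
  (a₁ , b₁) ⇒◇ (a₂ , b₂) = ((a₁ ⇒ a₂) ∧ (b₁ ⇒ b₂) , a₁ ⇒ b₂)

  𝟘◇ 𝟙◇ : Pair
  𝟘◇ = (𝟘 , 𝟘)
  𝟙◇ = (𝟙 , 𝟙)

  ⟦_⟧◇ : Term → (ℕ → Pair) → Pair
  ⟦ t ⟧◇ ρ = evalRaw _∧◇_ _∨◇_ _⊙◇_ _⇒◇_ 𝟘◇ 𝟙◇ ρ t

  DiamondInVariety : Equations → Set a
  DiamondInVariety E = ∀ s t → E s t → ∀ (ρ : ℕ → Pair) →
    (∀ n → proj₁ (ρ n) ≤ proj₂ (ρ n)) →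
    (proj₁ (⟦ s ⟧◇ ρ) ≈ proj₁ (⟦ t ⟧◇ ρ)) × (proj₂ (⟦ s ⟧◇ ρ) ≈ proj₂ (⟦ t ⟧◇ ρ))

DiamondClosed : (a : Level) → Equations → Set (suc a)
DiamondClosed a E = ∀ (A : ResLattice a) → InVariety E A → Diamond.DiamondInVariety A E

record Hom {a b} (A : ResLattice a) (B : ResLattice b) : Set (a Level.⊔ b) where
  private
    module A = ResLattice A
    module B = ResLattice B
  field
    f      : A.Carrier → B.Carrier
    f-cong : ∀ {x y} → x A.≈ y → f x B.≈ f y
    f-∧    : ∀ x y → f (x A.∧ y) B.≈ (f x B.∧ f y)
    f-∨    : ∀ x y → f (x A.∨ y) B.≈ (f x B.∨ f y)
    f-⊙    : ∀ x y → f (x A.⊙ y) B.≈ (f x B.⊙ f y)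
    f-⇒    : ∀ x y → f (x A.⇒ y) B.≈ (f x B.⇒ f y)
    f-𝟘    : f A.𝟘 B.≈ B.𝟘
    f-𝟙    : f A.𝟙 B.≈ B.𝟙

open Hom public using (f)

Injective : ∀ {a b} {A : ResLattice a} {B : ResLattice b} → Hom A B → Set (a Level.⊔ b)
Injective {A = A} {B = B} h =
  ∀ x y → ResLattice._≈_ B (f h x) (f h y) → ResLattice._≈_ A x y

-- A is an absolute retract in the subvariety given by E
-- (B ranges over members of the subvariety at the same level as A).
AbsoluteRetract : ∀ {a} → Equations → ResLattice a → Set (suc a)
AbsoluteRetract {a} E A =
  ∀ (B : ResLattice a) → InVariety E B → (i : Hom A B) → Injective i →
  Σ (Hom B A) λ r → ∀ x → ResLattice._≈_ A (f r (f i x)) x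

-- A is trivial: exactly one element (up to its equality; it is inhabited by 0).
Trivial : ∀ {a} → ResLattice a → Set a
Trivial A = ∀ x y → ResLattice._≈_ A x y

-- A embeds in A◇ by the diagonal x ↦ (x, x), and A◇ lies in the variety, so an
-- absolute retract A has a retraction r : A◇ → A.  Put u = (0, 1) and c = r u.
-- Since u ⊙ u = (0, 0), c ⊙ c = 0; since (x, x) ⊙ u = (x, x) ∧ u, applying r at
-- x = c gives c ⊙ c = c ∧ c = c, so c = 0.  But u ⇒ (0, 0) = u, so also
-- c = c ⇒ 0 = 0 ⇒ 0 = 1.  Hence 0 = 1 and A is trivial.
module Submission where

open import Defs
open import Level using (Level)
open import Function using (_on_)
open import Data.Nat using (ℕ)
open import Data.Product using (_,_; proj₁; proj₂; Σ; uncurry)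
open import Data.Product.Relation.Binary.Pointwise.NonDependent using (Pointwise; ×-isEquivalence)
open import Relation.Binary.Structures using (IsEquivalence; IsPartialOrder)
import Relation.Binary.Construct.On as On
import Relation.Binary.Lattice as Order
import Relation.Binary.Lattice.Properties.JoinSemilattice as JoinProperties
import Relation.Binary.Lattice.Properties.MeetSemilattice as MeetProperties
import Relation.Binary.Reasoning.Setoid as ≈-Reasoning
open import Relation.Binary.PropositionalEquality using (_≡_; cong₂; subst₂) renaming (refl to ≡-refl; sym to ≡-sym)
open import Algebra.Bundles using (CommutativeSemigroup)
open import Algebra.Structures using (IsCommutativeMonoid)
open import Algebra.Lattice.Bundles using (Lattice)
open import Algebra.Lattice.Structures using (IsLattice)
import Algebra.Lattice.Properties.Lattice as LatticeProperties
import Algebra.Properties.CommutativeSemigroup as CommutativeSemigroupProperties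

module ResLatticeProperties {a} (A : ResLattice a) where
  open ResLattice A
  open IsLattice isLattice public
  open IsCommutativeMonoid isCommutativeMonoid public using ()
    renaming (assoc to ⊙-assoc; comm to ⊙-comm; identityˡ to ⊙-identityˡ;
              identityʳ to ⊙-identityʳ; ∙-cong to ⊙-cong)

  private
    ⊙-commutativeSemigroup : CommutativeSemigroup a a
    ⊙-commutativeSemigroup = record
      { isCommutativeSemigroup = IsCommutativeMonoid.isCommutativeSemigroup isCommutativeMonoid }

  open CommutativeSemigroupProperties ⊙-commutativeSemigroup public
    using (x∙yz≈y∙xz; x∙yz≈yx∙z)

  -- The library's natural order on a lattice is x ≈ x ∧ y, the converse
  -- equation of the one used for ResLattice._≤_.
  private
    lattice : Lattice a a
    lattice = record { isLattice = isLattice }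

    module Natural = Order.Lattice (LatticeProperties.∨-∧-orderTheoreticLattice lattice)

  open LatticeProperties lattice public using (∧-idem; ∨-idem)

  ≤-isPartialOrder : IsPartialOrder _≈_ _≤_
  ≤-isPartialOrder = record
    { isPreorder = record
      { isEquivalence = isEquivalence
      ; reflexive     = λ x≈y → sym (Natural.reflexive x≈y)
      ; trans         = λ x≤y y≤z → sym (Natural.trans (sym x≤y) (sym y≤z))
      }
    ; antisym = λ x≤y y≤x → Natural.antisym (sym x≤y) (sym y≤x)
    }

  ≤-lattice : Order.Lattice a a a
  ≤-lattice = record
    { isLattice = record
      { isPartialOrder = ≤-isPartialOrder
      ; supremum = λ x y → let x≤ , y≤ , least = Natural.supremum x y in
          sym x≤ , sym y≤ , λ z x≤z y≤z → sym (least z (sym x≤z) (sym y≤z))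
      ; infimum = λ x y → let ≤x , ≤y , greatest = Natural.infimum x y in
          sym ≤x , sym ≤y , λ z z≤x z≤y → sym (greatest z (sym z≤x) (sym z≤y))
      }
    }

  open Order.Lattice ≤-lattice public
    using (setoid; x≤x∨y; y≤x∨y; ∨-least; x∧y≤x; x∧y≤y; ∧-greatest; antisym; ≤-respˡ-≈; ≤-respʳ-≈)
    renaming (refl to ≤-refl; reflexive to ≤-reflexive; trans to ≤-trans)
  open JoinProperties (Order.Lattice.joinSemilattice ≤-lattice) public
    using (∨-monotonic; x≤y⇒x∨y≈y)
  open MeetProperties (Order.Lattice.meetSemilattice ≤-lattice) public
    using (∧-monotonic)

  ⊙-monoˡ-≤ : ∀ z {x y} → x ≤ y → x ⊙ z ≤ y ⊙ z
  ⊙-monoˡ-≤ z {x} {y} x≤y =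
    residuation₂ x z (y ⊙ z) (≤-trans x≤y (residuation₁ y z (y ⊙ z) ≤-refl))

  ⊙-monoʳ-≤ : ∀ z {x y} → x ≤ y → z ⊙ x ≤ z ⊙ y
  ⊙-monoʳ-≤ z {x} {y} x≤y =
    ≤-respʳ-≈ (⊙-comm y z) (≤-respˡ-≈ (⊙-comm x z) (⊙-monoˡ-≤ z x≤y))

  ⇒-monoʳ-≤ : ∀ x {y z} → y ≤ z → x ⇒ y ≤ x ⇒ z
  ⇒-monoʳ-≤ x {y} {z} y≤z =
    residuation₁ (x ⇒ y) x z (≤-trans (residuation₂ (x ⇒ y) x y ≤-refl) y≤z)

  ⊙-distribˡ-∨ : ∀ z x y → z ⊙ (x ∨ y) ≈ z ⊙ x ∨ z ⊙ y
  ⊙-distribˡ-∨ z x y = antisym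
    (≤-respˡ-≈ (⊙-comm (x ∨ y) z)
      (residuation₂ (x ∨ y) z _ (∨-least (≤z⇒ (x≤x∨y _ _)) (≤z⇒ (y≤x∨y _ _)))))
    (∨-least (⊙-monoʳ-≤ z (x≤x∨y x y)) (⊙-monoʳ-≤ z (y≤x∨y x y)))
    where
    ≤z⇒ : ∀ {w u} → z ⊙ w ≤ u → w ≤ z ⇒ u
    ≤z⇒ {w} {u} zw≤u = residuation₁ w z u (≤-respˡ-≈ (⊙-comm z w) zw≤u)

  ⊙-zeroˡ : ∀ x → 𝟘 ⊙ x ≈ 𝟘
  ⊙-zeroˡ x = antisym (residuation₂ 𝟘 x 𝟘 (𝟘-bottom _)) (𝟘-bottom _)

  ⊙-zeroʳ : ∀ x → x ⊙ 𝟘 ≈ 𝟘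
  ⊙-zeroʳ x = trans (⊙-comm x 𝟘) (⊙-zeroˡ x)

  ∧-zeroʳ : ∀ x → x ∧ 𝟘 ≈ 𝟘
  ∧-zeroʳ x = trans (∧-comm x 𝟘) (𝟘-bottom x)

  ∨-identityʳ : ∀ x → x ∨ 𝟘 ≈ x
  ∨-identityʳ x = trans (∨-comm x 𝟘) (x≤y⇒x∨y≈y (𝟘-bottom x))

  𝟙⇒x≈x : ∀ x → 𝟙 ⇒ x ≈ x
  𝟙⇒x≈x x = antisym
    (≤-respˡ-≈ (⊙-identityʳ _) (residuation₂ _ 𝟙 x ≤-refl))
    (residuation₁ x 𝟙 x (≤-reflexive (⊙-identityʳ x)))

  𝟘⇒x≈𝟙 : ∀ x → 𝟘 ⇒ x ≈ 𝟙
  𝟘⇒x≈𝟙 x = antisym (𝟙-top _) (residuation₁ 𝟙 𝟘 x (≤-respˡ-≈ (sym (⊙-zeroʳ 𝟙)) (𝟘-bottom x)))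

  𝟘≈𝟙⇒trivial : 𝟘 ≈ 𝟙 → Trivial A
  𝟘≈𝟙⇒trivial 𝟘≈𝟙 x y = trans (≈𝟘 x) (sym (≈𝟘 y))
    where
    ≈𝟘 : ∀ x → x ≈ 𝟘
    ≈𝟘 x = trans (sym (𝟙-top x)) (trans (∧-congˡ (sym 𝟘≈𝟙)) (∧-zeroʳ x))

module DiamondLattice {a} (A : ResLattice a) where
  open ResLattice A
  open ResLatticeProperties A
  open Diamond A

  Carrier◇ : Set a
  Carrier◇ = Σ Pair (uncurry _≤_)

  infix 4 _≈²_ _≤²_ _≈◇_

  _≈²_ _≤²_ : Pair → Pair → Set a
  _≈²_ = Pointwise _≈_ _≈_
  _≤²_ = Pointwise _≤_ _≤_

  _≈◇_ : Carrier◇ → Carrier◇ → Set a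
  _≈◇_ = _≈²_ on proj₁

  ≈◇-isEquivalence : IsEquivalence _≈◇_
  ≈◇-isEquivalence = On.isEquivalence proj₁ (×-isEquivalence isEquivalence isEquivalence)

  ⊙◇-closed : ∀ {a₁ b₁ a₂ b₂} → a₁ ≤ b₁ → a₂ ≤ b₂ → a₁ ⊙ a₂ ≤ a₁ ⊙ b₂ ∨ a₂ ⊙ b₁
  ⊙◇-closed {a₁} _ a₂≤b₂ = ≤-trans (⊙-monoʳ-≤ a₁ a₂≤b₂) (x≤x∨y _ _)

  ⇒◇-closed : ∀ {a₁ b₁ a₂ b₂} → a₁ ≤ b₁ → a₂ ≤ b₂ → (a₁ ⇒ a₂) ∧ (b₁ ⇒ b₂) ≤ a₁ ⇒ b₂
  ⇒◇-closed {a₁} _ a₂≤b₂ = ≤-trans (x∧y≤x _ _) (⇒-monoʳ-≤ a₁ a₂≤b₂)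

  _∧′_ _∨′_ _⊙′_ _⇒′_ : Carrier◇ → Carrier◇ → Carrier◇
  (p , p≤) ∧′ (q , q≤) = p ∧◇ q , ∧-monotonic p≤ q≤
  (p , p≤) ∨′ (q , q≤) = p ∨◇ q , ∨-monotonic p≤ q≤
  (p , p≤) ⊙′ (q , q≤) = p ⊙◇ q , ⊙◇-closed p≤ q≤
  (p , p≤) ⇒′ (q , q≤) = p ⇒◇ q , ⇒◇-closed p≤ q≤

  ⊙◇-assoc₂ : ∀ x₁ x₂ y₁ y₂ z₁ z₂ →
    (x₁ ⊙ y₁) ⊙ z₂ ∨ z₁ ⊙ (x₁ ⊙ y₂ ∨ y₁ ⊙ x₂) ≈ x₁ ⊙ (y₁ ⊙ z₂ ∨ z₁ ⊙ y₂) ∨ (y₁ ⊙ z₁) ⊙ x₂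
  ⊙◇-assoc₂ x₁ x₂ y₁ y₂ z₁ z₂ = begin
    (x₁ ⊙ y₁) ⊙ z₂ ∨ z₁ ⊙ (x₁ ⊙ y₂ ∨ y₁ ⊙ x₂)
      ≈⟨ ∨-congˡ (⊙-distribˡ-∨ z₁ _ _) ⟩
    (x₁ ⊙ y₁) ⊙ z₂ ∨ z₁ ⊙ (x₁ ⊙ y₂) ∨ z₁ ⊙ (y₁ ⊙ x₂)
      ≈⟨ sym (∨-assoc _ _ _) ⟩
    ((x₁ ⊙ y₁) ⊙ z₂ ∨ z₁ ⊙ (x₁ ⊙ y₂)) ∨ z₁ ⊙ (y₁ ⊙ x₂)
      ≈⟨ ∨-cong (∨-cong (⊙-assoc x₁ y₁ z₂) (x∙yz≈y∙xz z₁ x₁ y₂)) (x∙yz≈yx∙z z₁ y₁ x₂) ⟩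
    (x₁ ⊙ (y₁ ⊙ z₂) ∨ x₁ ⊙ (z₁ ⊙ y₂)) ∨ (y₁ ⊙ z₁) ⊙ x₂
      ≈⟨ ∨-congʳ (sym (⊙-distribˡ-∨ x₁ _ _)) ⟩
    x₁ ⊙ (y₁ ⊙ z₂ ∨ z₁ ⊙ y₂) ∨ (y₁ ⊙ z₁) ⊙ x₂
      ∎
    where open ≈-Reasoning setoid

  ⊙◇-residuation₁ : ∀ p q r → (p ⊙◇ q) ≤² r → p ≤² (q ⇒◇ r)
  ⊙◇-residuation₁ (a₁ , b₁) (a₂ , b₂) (a₃ , b₃) (≤a₃ , ≤b₃) =
    ∧-greatest (residuation₁ a₁ a₂ a₃ ≤a₃) (residuation₁ a₁ b₂ b₃ (≤-trans (x≤x∨y _ _) ≤b₃)) ,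
    residuation₁ b₁ a₂ b₃ (≤-respˡ-≈ (⊙-comm a₂ b₁) (≤-trans (y≤x∨y _ _) ≤b₃))

  ⊙◇-residuation₂ : ∀ p q r → p ≤² (q ⇒◇ r) → (p ⊙◇ q) ≤² r
  ⊙◇-residuation₂ (a₁ , b₁) (a₂ , b₂) (a₃ , b₃) (a₁≤ , b₁≤) =
    residuation₂ a₁ a₂ a₃ (≤-trans a₁≤ (x∧y≤x _ _)) ,
    ∨-least (residuation₂ a₁ b₂ b₃ (≤-trans a₁≤ (x∧y≤y _ _)))
            (≤-respˡ-≈ (⊙-comm b₁ a₂) (residuation₂ b₁ a₂ b₃ b₁≤))

  ⊙◇-identityˡ : ∀ ((p , _) : Carrier◇) → (𝟙◇ ⊙◇ p) ≈² p
  ⊙◇-identityˡ ((a , b) , a≤b) =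
    ⊙-identityˡ a , trans (∨-cong (⊙-identityˡ b) (⊙-identityʳ a)) (trans (∨-comm b a) (x≤y⇒x∨y≈y a≤b))

  ⊙◇-identityʳ : ∀ ((p , _) : Carrier◇) → (p ⊙◇ 𝟙◇) ≈² p
  ⊙◇-identityʳ ((a , b) , a≤b) =
    ⊙-identityʳ a , trans (∨-cong (⊙-identityʳ a) (⊙-identityˡ b)) (x≤y⇒x∨y≈y a≤b)

  A◇ : ResLattice a
  A◇ = record
    { Carrier = Carrier◇
    ; _≈_ = _≈◇_
    ; _∧_ = _∧′_
    ; _∨_ = _∨′_
    ; _⊙_ = _⊙′_
    ; _⇒_ = _⇒′_
    ; 𝟘 = 𝟘◇ , ≤-refl
    ; 𝟙 = 𝟙◇ , ≤-refl
    ; isLattice = record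
      { isEquivalence = ≈◇-isEquivalence
      ; ∨-comm = λ _ _ → ∨-comm _ _ , ∨-comm _ _
      ; ∨-assoc = λ _ _ _ → ∨-assoc _ _ _ , ∨-assoc _ _ _
      ; ∨-cong = λ (a≈ , b≈) (a≈′ , b≈′) → ∨-cong a≈ a≈′ , ∨-cong b≈ b≈′
      ; ∧-comm = λ _ _ → ∧-comm _ _ , ∧-comm _ _
      ; ∧-assoc = λ _ _ _ → ∧-assoc _ _ _ , ∧-assoc _ _ _
      ; ∧-cong = λ (a≈ , b≈) (a≈′ , b≈′) → ∧-cong a≈ a≈′ , ∧-cong b≈ b≈′
      ; absorptive = (λ _ _ → ∨-absorbs-∧ _ _ , ∨-absorbs-∧ _ _)
                   , (λ _ _ → ∧-absorbs-∨ _ _ , ∧-absorbs-∨ _ _)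
      }
    ; isCommutativeMonoid = record
      { isMonoid = record
        { isSemigroup = record
          { isMagma = record
            { isEquivalence = ≈◇-isEquivalence
            ; ∙-cong = λ (a≈ , b≈) (a≈′ , b≈′) →
                ⊙-cong a≈ a≈′ , ∨-cong (⊙-cong a≈ b≈′) (⊙-cong a≈′ b≈)
            }
          ; assoc = λ (((x₁ , x₂) , _)) (((y₁ , y₂) , _)) (((z₁ , z₂) , _)) →
              ⊙-assoc x₁ y₁ z₁ , ⊙◇-assoc₂ x₁ x₂ y₁ y₂ z₁ z₂
          }
        ; identity = ⊙◇-identityˡ , ⊙◇-identityʳ
        }
      ; comm = λ _ _ → ⊙-comm _ _ , ∨-comm _ _
      }
    ; ⇒-cong = λ (a≈ , b≈) (a≈′ , b≈′) → ∧-cong (⇒-cong a≈ a≈′) (⇒-cong b≈ b≈′) , ⇒-cong a≈ b≈′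
    ; 𝟘-bottom = λ _ → 𝟘-bottom _ , 𝟘-bottom _
    ; 𝟙-top = λ _ → 𝟙-top _ , 𝟙-top _
    ; residuation₁ = λ x y z → ⊙◇-residuation₁ (proj₁ x) (proj₁ y) (proj₁ z)
    ; residuation₂ = λ x y z → ⊙◇-residuation₂ (proj₁ x) (proj₁ y) (proj₁ z)
    }

  proj₁-⟦⟧≡⟦⟧◇ : ∀ t (ρ : ℕ → Carrier◇) → proj₁ (⟦ A◇ ⟧ t ρ) ≡ ⟦ t ⟧◇ (λ n → proj₁ (ρ n))
  proj₁-⟦⟧≡⟦⟧◇ (var n)  ρ = ≡-refl
  proj₁-⟦⟧≡⟦⟧◇ (s ∧ₜ t) ρ = cong₂ _∧◇_ (proj₁-⟦⟧≡⟦⟧◇ s ρ) (proj₁-⟦⟧≡⟦⟧◇ t ρ)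
  proj₁-⟦⟧≡⟦⟧◇ (s ∨ₜ t) ρ = cong₂ _∨◇_ (proj₁-⟦⟧≡⟦⟧◇ s ρ) (proj₁-⟦⟧≡⟦⟧◇ t ρ)
  proj₁-⟦⟧≡⟦⟧◇ (s ⊙ₜ t) ρ = cong₂ _⊙◇_ (proj₁-⟦⟧≡⟦⟧◇ s ρ) (proj₁-⟦⟧≡⟦⟧◇ t ρ)
  proj₁-⟦⟧≡⟦⟧◇ (s ⇒ₜ t) ρ = cong₂ _⇒◇_ (proj₁-⟦⟧≡⟦⟧◇ s ρ) (proj₁-⟦⟧≡⟦⟧◇ t ρ)
  proj₁-⟦⟧≡⟦⟧◇ 𝟘ₜ       ρ = ≡-refl
  proj₁-⟦⟧≡⟦⟧◇ 𝟙ₜ       ρ = ≡-refl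

  A◇-inVariety : ∀ {E} → DiamondInVariety E → InVariety E A◇
  A◇-inVariety ◇⊨E s t s≐t ρ =
    subst₂ _≈²_ (≡-sym (proj₁-⟦⟧≡⟦⟧◇ s ρ)) (≡-sym (proj₁-⟦⟧≡⟦⟧◇ t ρ))
      (◇⊨E s t s≐t (λ n → proj₁ (ρ n)) (λ n → proj₂ (ρ n)))

  diagonal : Hom A A◇
  diagonal = record
    { f      = λ x → (x , x) , ≤-refl
    ; f-cong = λ x≈y → x≈y , x≈y
    ; f-∧    = λ _ _ → refl , refl
    ; f-∨    = λ _ _ → refl , refl
    ; f-⊙    = λ x y → refl , sym (trans (∨-congˡ (⊙-comm y x)) (∨-idem _))
    ; f-⇒    = λ _ _ → sym (∧-idem _) , refl
    ; f-𝟘    = refl , refl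
    ; f-𝟙    = refl , refl
    }

  diagonal-injective : Injective diagonal
  diagonal-injective _ _ = proj₁

  module _ (r : Hom A◇ A) (r∘diagonal≈id : ∀ x → f r (f diagonal x) ≈ x) where
    private
      module ◇ = ResLattice A◇
      module r = Hom r
      open ≈-Reasoning setoid

      u : Carrier◇
      u = (𝟘 , 𝟙) , 𝟘-bottom 𝟙

      c : Carrier
      c = f r u

      u⊙u≈𝟘 : u ◇.⊙ u ◇.≈ ◇.𝟘
      u⊙u≈𝟘 = ⊙-zeroˡ 𝟘 , trans (∨-idem _) (⊙-zeroˡ 𝟙)

      u⇒𝟘≈u : (u ◇.⇒ ◇.𝟘) ◇.≈ u
      u⇒𝟘≈u = trans (∧-congˡ (𝟙⇒x≈x 𝟘)) (∧-zeroʳ _) , 𝟘⇒x≈𝟙 𝟘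

      ⊙u≈∧u : ∀ x → f diagonal x ◇.⊙ u ◇.≈ f diagonal x ◇.∧ u
      ⊙u≈∧u x = trans (⊙-zeroʳ x) (sym (∧-zeroʳ x))
              , trans (∨-cong (⊙-identityʳ x) (⊙-zeroˡ x)) (trans (∨-identityʳ x) (sym (𝟙-top x)))

      c⊙c≈𝟘 : c ⊙ c ≈ 𝟘
      c⊙c≈𝟘 = begin
        c ⊙ c         ≈⟨ r.f-⊙ u u ⟨
        f r (u ◇.⊙ u) ≈⟨ r.f-cong u⊙u≈𝟘 ⟩
        f r ◇.𝟘       ≈⟨ r.f-𝟘 ⟩
        𝟘             ∎

      c≈c⊙c : c ≈ c ⊙ c
      c≈c⊙c = begin
        c                              ≈⟨ ∧-idem c ⟨
        c ∧ c                          ≈⟨ ∧-congʳ (r∘diagonal≈id c) ⟨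
        f r (f diagonal c) ∧ c         ≈⟨ r.f-∧ (f diagonal c) u ⟨
        f r (f diagonal c ◇.∧ u)       ≈⟨ r.f-cong (⊙u≈∧u c) ⟨
        f r (f diagonal c ◇.⊙ u)       ≈⟨ r.f-⊙ (f diagonal c) u ⟩
        f r (f diagonal c) ⊙ c         ≈⟨ ⊙-cong (r∘diagonal≈id c) refl ⟩
        c ⊙ c                          ∎

      c≈𝟘 : c ≈ 𝟘
      c≈𝟘 = trans c≈c⊙c c⊙c≈𝟘

      c≈𝟙 : c ≈ 𝟙
      c≈𝟙 = begin
        c                   ≈⟨ r.f-cong u⇒𝟘≈u ⟨
        f r (u ◇.⇒ ◇.𝟘)     ≈⟨ r.f-⇒ u ◇.𝟘 ⟩
        c ⇒ f r ◇.𝟘         ≈⟨ ⇒-cong c≈𝟘 r.f-𝟘 ⟩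
        𝟘 ⇒ 𝟘               ≈⟨ 𝟘⇒x≈𝟙 𝟘 ⟩
        𝟙                   ∎

    diagonal-retraction⇒trivial : Trivial A
    diagonal-retraction⇒trivial = 𝟘≈𝟙⇒trivial (trans (sym c≈𝟘) c≈𝟙)

theorem5p3 : (a : Level) (E : Equations) → DiamondClosed a E →
    (A : ResLattice a) → InVariety E A → AbsoluteRetract E A → Trivial A
theorem5p3 a E closed A A⊨E retract =
  let r , r∘diagonal≈id = retract A◇ (A◇-inVariety (closed A A⊨E)) diagonal diagonal-injective
  in  diagonal-retraction⇒trivial r r∘diagonal≈id
  where open DiamondLattice A
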